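{- Let $(a,b)$ and $(a',b)$ be two different loop-digraphic lists of length $n$ such that $a$ is nonincreasing and $a\prec a'$. Then $N_1(a,b)>N_1(a',b)$.
   Context: $(a,b)$ denotes $((a_1,b_1),\dots,(a_n,b_n))$ with nonnegative integers. A loop-digraph realization is a digraph without multiple arcs and with at most one loop per vertex on labeled vertices $v_1,\dots,v_n$ with indegree $a_i$ and outdegree $b_i$ at $v_i$ (a loop counts for both); equivalently an $n\times n$ $(0,1)$-matrix with row sums $b_i$ and column sums $a_i$. $(a,b)$ is loop-digraphic if one exists, and $N_1(a,b)$ is the number of them. Majorization: $a\prec a'$ iff $\sum_{i=1}^k a_i\le\sum_{i=1}^k a'_i$ for $k=1,\dots,n-1$ and the total sums are equal (partial sums in the given order). -}

module Defs where

open import Data.Nat using (ℕ; zero; suc; _+_; _≤_; _<_; _<ᵇ_)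
open import Data.Bool using (Bool; true; false; if_then_else_)
open import Data.Fin using (Fin; toℕ; _≤_)
import Data.Fin as F
open import Data.Fin.Properties using (all?)
open import Data.List using (List; []; _∷_; concatMap; map; length; filter)
open import Data.Product using (_×_; ∃)
open import Data.Nat.Properties using (_≟_)
open import Relation.Binary.PropositionalEquality using (_≡_)
open import Relation.Nullary using (Dec; ¬_)
open import Relation.Nullary.Decidable using (_×-dec_)

sumFin : (n : ℕ) → (Fin n → ℕ) → ℕ
sumFin zero    f = 0
sumFin (suc n) f = f F.zero + sumFin n (λ i → f (F.suc i))

DegList : ℕ → Set
DegList n = Fin n → ℕ

-- (0,1)-matrix; M i j = true means the arc v_i → v_j (i = j : loop)
Matrix01 : ℕ → Set
Matrix01 n = Fin n → Fin n → Bool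

b2n : Bool → ℕ
b2n true  = 1
b2n false = 0

rowSum : {n : ℕ} → Matrix01 n → Fin n → ℕ
rowSum {n} M i = sumFin n (λ j → b2n (M i j))

colSum : {n : ℕ} → Matrix01 n → Fin n → ℕ
colSum {n} M j = sumFin n (λ i → b2n (M i j))

-- loop-digraph realization of (a,b): indegree a_i, outdegree b_i at v_i
IsRealization : {n : ℕ} → DegList n → DegList n → Matrix01 n → Set
IsRealization a b M = (∀ i → rowSum M i ≡ b i) × (∀ j → colSum M j ≡ a j)

isRealization? : {n : ℕ} (a b : DegList n) (M : Matrix01 n) → Dec (IsRealization a b M)
isRealization? a b M =
  all? (λ i → rowSum M i ≟ b i) ×-dec all? (λ j → colSum M j ≟ a j)

LoopDigraphic : {n : ℕ} → DegList n → DegList n → Set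
LoopDigraphic a b = ∃ λ M → IsRealization a b M

allFuns : {A : Set} (m : ℕ) → List A → List (Fin m → A)
allFuns zero    xs = (λ ()) ∷ []
allFuns (suc m) xs =
  concatMap (λ x → map (λ f → λ { F.zero → x ; (F.suc i) → f i }) (allFuns m xs)) xs

allMatrices : (n : ℕ) → List (Matrix01 n)
allMatrices n = allFuns n (allFuns n (false ∷ true ∷ []))

-- N_1(a,b): number of loop-digraph realizations (all 0/1 matrices are enumerated
-- exactly once by allMatrices)
N₁ : {n : ℕ} → DegList n → DegList n → ℕ
N₁ {n} a b = length (filter (isRealization? a b) (allMatrices n))

psum : {n : ℕ} → DegList n → ℕ → ℕ
psum {n} a k = sumFin n (λ i → if toℕ i <ᵇ k then a i else 0)

-- majorization a ≺ a' (partial sums in the given order)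
_≺_ : {n : ℕ} → DegList n → DegList n → Set
_≺_ {n} a a' = (∀ k → 1 Data.Nat.≤ k → k < n → psum a k Data.Nat.≤ psum a' k)
             × sumFin n a ≡ sumFin n a'

Nonincreasing : {n : ℕ} → DegList n → Set
Nonincreasing {n} a = ∀ (i j : Fin n) → i Data.Fin.≤ j → a j Data.Nat.≤ a i

-- Counting realizations row by row expresses N₁(a,b) through the column sums a. Moving one unit of
-- column sum from a column with p+1 to a column with q < p never decreases the count, and strictly
-- increases it unless it was zero: pairing every first row with its mirror image under the transposition
-- of the two columns reduces this to the same statement for the remaining rows. Since a is nonincreasing
-- and a ≺ a′ ≠ a, the vector a′ is carried to a by finitely many such moves, each taking a unit from the
-- first entry where a′ exceeds a to the first later entry where it falls short; this preserves the
-- majorization and decreases Σᵢ (a′ᵢ ∸ aᵢ). Realizability of (a′,b) makes the count for a′ positive.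

module Submission where

open import Defs
open import Level using (0ℓ)
open import Data.Nat using (ℕ; zero; suc; _+_; _*_; _∸_; _≤_; _<_; z≤n; s≤s; s≤s⁻¹; z<s; _<ᵇ_; pred; ≢-nonZero)
open import Data.Nat.Properties
open import Data.Bool using (Bool; true; false; if_then_else_)
open import Data.Bool.Properties using () renaming (≡-decSetoid to Bool-decSetoid)
open import Data.Fin using (Fin; toℕ; fromℕ<)
import Data.Fin as F
open import Data.Fin.Properties using (all?; ¬∀⟶∃¬-smallest; toℕ-injective; toℕ-inject; toℕ-fromℕ<; toℕ<n) renaming (_≟_ to _≟ᶠ_)
open import Data.Fin.Permutation using (Permutation; _⟨$⟩ʳ_; _⟨$⟩ˡ_; inverseʳ; inverseˡ; transpose)
open import Data.Vec.Functional as V using (updateAt)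
open import Data.Vec.Functional.Properties using (updateAt-updates; updateAt-minimal)
import Data.Vec.Functional.Relation.Binary.Pointwise.Properties as Pointwise
open import Data.List using (List; []; _∷_; concatMap; map; length; filter; _++_)
open import Data.Product using (_×_; _,_; proj₁; proj₂; ∃)
open import Data.Sum using (_⊎_; inj₁; inj₂; [_,_]′)
open import Function using (_∘_; id; const; _⇔_; mk⇔; Equivalence)
open Equivalence using (to; from)
open import Relation.Binary using (DecSetoid; tri<; tri≈; tri>)
open import Relation.Nullary using (Dec; yes; no; ¬_; does; contradiction)
open import Relation.Nullary.Decidable using (_×-dec_; _→-dec_; ¬?; dec-true; dec-false)
open import Relation.Unary using (Pred; Decidable)
open import Relation.Binary.PropositionalEquality
open import Algebra.Properties.CommutativeMonoid.Sum +-0-commutativeMonoid using (sum; ∑-permute)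
open import Algebra.Properties.CommutativeSemigroup +-commutativeSemigroup using () renaming (interchange to +-interchange)
open import Induction.WellFounded using (Acc; acc)
open import Data.Nat.Induction using (<-wellFounded)

⟦_⟧ : {P : Set} → Dec P → ℕ
⟦ d ⟧ = b2n (does d)

⟦⟧-cong : {P Q : Set} → (P → Q) → (Q → P) → (d : Dec P) (e : Dec Q) → ⟦ d ⟧ ≡ ⟦ e ⟧
⟦⟧-cong f g (yes p) (yes q) = refl
⟦⟧-cong f g (yes p) (no ¬q) = contradiction (f p) ¬q
⟦⟧-cong f g (no ¬p) (yes q) = contradiction (g q) ¬p
⟦⟧-cong f g (no _)  (no _)  = refl

⟦⟧-× : {P Q : Set} (d : Dec P) (e : Dec Q) → ⟦ d ×-dec e ⟧ ≡ ⟦ d ⟧ * ⟦ e ⟧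
⟦⟧-× (yes _) (yes _) = refl
⟦⟧-× (yes _) (no _)  = refl
⟦⟧-× (no _)  _       = refl

⟦⟧-yes : {P : Set} (d : Dec P) → P → ⟦ d ⟧ ≡ 1
⟦⟧-yes d p = cong b2n (dec-true d p)

⟦⟧-no : {P : Set} (d : Dec P) → ¬ P → ⟦ d ⟧ ≡ 0
⟦⟧-no d ¬p = cong b2n (dec-false d ¬p)

⟦⟧*-≤ : {P : Set} (d : Dec P) (k : ℕ) → ⟦ d ⟧ * k ≤ k
⟦⟧*-≤ (yes _) k = ≤-reflexive (+-identityʳ k)
⟦⟧*-≤ (no _)  k = z≤n

sumL : {A : Set} → List A → (A → ℕ) → ℕ
sumL []       h = 0
sumL (x ∷ xs) h = h x + sumL xs h

module _ {A : Set} where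

  sumL-cong : (xs : List A) {h g : A → ℕ} → (∀ x → h x ≡ g x) → sumL xs h ≡ sumL xs g
  sumL-cong []       e = refl
  sumL-cong (x ∷ xs) e = cong₂ _+_ (e x) (sumL-cong xs e)

  sumL-zero : (xs : List A) → sumL xs (λ _ → 0) ≡ 0
  sumL-zero []       = refl
  sumL-zero (x ∷ xs) = sumL-zero xs

  sumL-++ : (xs ys : List A) (h : A → ℕ) → sumL (xs ++ ys) h ≡ sumL xs h + sumL ys h
  sumL-++ []       ys h = refl
  sumL-++ (x ∷ xs) ys h = trans (cong (h x +_) (sumL-++ xs ys h)) (sym (+-assoc (h x) _ _))

  sumL-+ : (xs : List A) (h g : A → ℕ) → sumL xs (λ x → h x + g x) ≡ sumL xs h + sumL xs g
  sumL-+ []       h g = refl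
  sumL-+ (x ∷ xs) h g = trans (cong (h x + g x +_) (sumL-+ xs h g)) (+-interchange (h x) (g x) _ _)

  sumL-*ˡ : (xs : List A) (k : ℕ) (h : A → ℕ) → sumL xs (λ x → k * h x) ≡ k * sumL xs h
  sumL-*ˡ []       k h = sym (*-zeroʳ k)
  sumL-*ˡ (x ∷ xs) k h = trans (cong (k * h x +_) (sumL-*ˡ xs k h)) (sym (*-distribˡ-+ k (h x) _))

  sumL-mono : (xs : List A) {h g : A → ℕ} → (∀ x → h x ≤ g x) → sumL xs h ≤ sumL xs g
  sumL-mono []       e = z≤n
  sumL-mono (x ∷ xs) e = +-mono-≤ (e x) (sumL-mono xs e)

  sumL-concatMap : {B : Set} (f : B → List A) (ys : List B) (h : A → ℕ) →
                   sumL (concatMap f ys) h ≡ sumL ys (λ y → sumL (f y) h)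
  sumL-concatMap f []       h = refl
  sumL-concatMap f (y ∷ ys) h =
    trans (sumL-++ (f y) (concatMap f ys) h) (cong (sumL (f y) h +_) (sumL-concatMap f ys h))

sumL-map : {A B : Set} (f : B → A) (ys : List B) (h : A → ℕ) → sumL (map f ys) h ≡ sumL ys (h ∘ f)
sumL-map f []       h = refl
sumL-map f (y ∷ ys) h = cong (h (f y) +_) (sumL-map f ys h)

sumL-comm : {A B : Set} (xs : List A) (ys : List B) (h : A → B → ℕ) →
            sumL xs (λ x → sumL ys (h x)) ≡ sumL ys (λ y → sumL xs (λ x → h x y))
sumL-comm []       ys h = sym (sumL-zero ys)
sumL-comm (x ∷ xs) ys h = trans (cong (sumL ys (h x) +_) (sumL-comm xs ys h)) (sym (sumL-+ ys (h x) _))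

length-filter-sumL : {A : Set} {P : A → Set} (P? : ∀ x → Dec (P x)) (xs : List A) →
                     length (filter P? xs) ≡ sumL xs (λ x → ⟦ P? x ⟧)
length-filter-sumL P? []       = refl
length-filter-sumL P? (x ∷ xs) with P? x
... | yes _ = cong suc (length-filter-sumL P? xs)
... | no  _ = length-filter-sumL P? xs

sumL-allFuns-suc : {A : Set} (m : ℕ) (xs : List A) (h : (Fin (suc m) → A) → ℕ) →
                   (∀ {f g} → f ≗ g → h f ≡ h g) →
                   sumL (allFuns (suc m) xs) h ≡ sumL xs (λ x → sumL (allFuns m xs) (λ f → h (x V.∷ f)))
sumL-allFuns-suc m xs h h-cong =
  trans (sumL-concatMap _ xs h)
        (sumL-cong xs λ x → trans (sumL-map _ (allFuns m xs) h)
                                  (sumL-cong (allFuns m xs) λ f → h-cong λ { F.zero → refl ; (F.suc i) → refl }))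

record Enumeration (S : DecSetoid 0ℓ 0ℓ) : Set where
  open DecSetoid S using (Carrier; _≈_) renaming (_≟_ to _≈?_)
  field
    elements    : List Carrier
    occurs-once : ∀ t → sumL elements (λ s → ⟦ s ≈? t ⟧) ≡ 1

  Respects≈ : (Carrier → ℕ) → Set
  Respects≈ h = ∀ {s t} → s ≈ t → h s ≡ h t

  sumL-count-one : (k : ℕ) (t : Carrier) → sumL elements (λ s → ⟦ s ≈? t ⟧ * k) ≡ k
  sumL-count-one k t = begin
    sumL elements (λ s → ⟦ s ≈? t ⟧ * k) ≡⟨ sumL-cong elements (λ s → *-comm ⟦ s ≈? t ⟧ k) ⟩
    sumL elements (λ s → k * ⟦ s ≈? t ⟧) ≡⟨ sumL-*ˡ elements k _ ⟩
    k * sumL elements (λ s → ⟦ s ≈? t ⟧) ≡⟨ cong (k *_) (occurs-once t) ⟩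
    k * 1                               ≡⟨ *-identityʳ k ⟩
    k                                   ∎
    where open ≡-Reasoning

  sumL-select : (h : Carrier → ℕ) → Respects≈ h → ∀ t → sumL elements (λ s → ⟦ s ≈? t ⟧ * h s) ≡ h t
  sumL-select h h-resp t = trans (sumL-cong elements at-t) (sumL-count-one (h t) t)
    where
    at-t : ∀ s → ⟦ s ≈? t ⟧ * h s ≡ ⟦ s ≈? t ⟧ * h t
    at-t s with s ≈? t
    ... | yes s≈t = cong (_+ 0) (h-resp s≈t)
    ... | no  _   = refl

  term≤sumL : (h : Carrier → ℕ) → Respects≈ h → ∀ t → h t ≤ sumL elements h
  term≤sumL h h-resp t = begin
    h t                                         ≡⟨ sumL-select h h-resp t ⟨
    sumL elements (λ s → ⟦ s ≈? t ⟧ * h s)       ≤⟨ sumL-mono elements (λ s → ⟦⟧*-≤ (s ≈? t) (h s)) ⟩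
    sumL elements h                             ∎
    where open ≤-Reasoning

  sumL-reindex : (h : Carrier → ℕ) → Respects≈ h → (φ ψ : Carrier → Carrier) →
                 (∀ {r s} → s ≈ φ r → r ≈ ψ s) → (∀ {r s} → r ≈ ψ s → s ≈ φ r) →
                 sumL elements (h ∘ φ) ≡ sumL elements h
  sumL-reindex h h-resp φ ψ φ⇒ψ ψ⇒φ = begin
    sumL elements (h ∘ φ)                                         ≡⟨ sumL-cong elements (λ r → sumL-select h h-resp (φ r)) ⟨
    sumL elements (λ r → sumL elements (λ s → ⟦ s ≈? φ r ⟧ * h s)) ≡⟨ sumL-comm elements elements _ ⟩
    sumL elements (λ s → sumL elements (λ r → ⟦ s ≈? φ r ⟧ * h s)) ≡⟨ sumL-cong elements (λ s → sumL-cong elements λ r →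
                                                                       cong (_* h s) (⟦⟧-cong φ⇒ψ ψ⇒φ (s ≈? φ r) (r ≈? ψ s))) ⟩
    sumL elements (λ s → sumL elements (λ r → ⟦ r ≈? ψ s ⟧ * h s)) ≡⟨ sumL-cong elements (λ s → sumL-count-one (h s) (ψ s)) ⟩
    sumL elements h                                               ∎
    where open ≡-Reasoning

boolEnumeration : Enumeration Bool-decSetoid
boolEnumeration = record
  { elements    = false ∷ true ∷ []
  ; occurs-once = λ { false → refl ; true → refl }
  }

funEnumeration : {S : DecSetoid 0ℓ 0ℓ} → Enumeration S → (m : ℕ) → Enumeration (Pointwise.decSetoid S m)
funEnumeration {S} E m = record { elements = allFuns m elements ; occurs-once = occurs-once′ m }
  where
  open DecSetoid S using (Carrier; _≈_) renaming (_≟_ to _≈?_)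
  open Enumeration E
  open ≡-Reasoning

  _≋?_ : ∀ {m} (s t : Fin m → Carrier) → Dec (∀ i → s i ≈ t i)
  s ≋? t = all? (λ i → s i ≈? t i)

  occurs-once′ : ∀ m (t : Fin m → Carrier) → sumL (allFuns m elements) (λ s → ⟦ s ≋? t ⟧) ≡ 1
  occurs-once′ zero    t = sumL-cong (allFuns 0 elements) (λ s → ⟦⟧-yes (s ≋? t) λ ())
  occurs-once′ (suc m) t = begin
    sumL (allFuns (suc m) elements) (λ s → ⟦ s ≋? t ⟧)
      ≡⟨ sumL-allFuns-suc m elements _ (λ {f} {g} f≗g → ⟦⟧-cong (λ H i → subst (_≈ t i) (f≗g i) (H i))
                                                                 (λ H i → subst (_≈ t i) (sym (f≗g i)) (H i))
                                                                 (f ≋? t) (g ≋? t)) ⟩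
    sumL elements (λ x → sumL (allFuns m elements) (λ f → ⟦ (x V.∷ f) ≋? t ⟧))
      ≡⟨ sumL-cong elements (λ x → sumL-cong (allFuns m elements) λ f → split x f) ⟩
    sumL elements (λ x → sumL (allFuns m elements) (λ f → ⟦ x ≈? t F.zero ⟧ * ⟦ f ≋? (t ∘ F.suc) ⟧))
      ≡⟨ sumL-cong elements (λ x → sumL-*ˡ (allFuns m elements) ⟦ x ≈? t F.zero ⟧ _) ⟩
    sumL elements (λ x → ⟦ x ≈? t F.zero ⟧ * sumL (allFuns m elements) (λ f → ⟦ f ≋? (t ∘ F.suc) ⟧))
      ≡⟨ sumL-cong elements (λ x → cong (⟦ x ≈? t F.zero ⟧ *_) (occurs-once′ m (t ∘ F.suc))) ⟩
    sumL elements (λ x → ⟦ x ≈? t F.zero ⟧ * 1)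
      ≡⟨ sumL-count-one 1 (t F.zero) ⟩
    1 ∎
    where
    split : ∀ x f → ⟦ (x V.∷ f) ≋? t ⟧ ≡ ⟦ x ≈? t F.zero ⟧ * ⟦ f ≋? (t ∘ F.suc) ⟧
    split x f = trans (⟦⟧-cong (λ H → H F.zero , H ∘ F.suc) (λ { (h₀ , hₛ) F.zero → h₀ ; (h₀ , hₛ) (F.suc i) → hₛ i })
                               ((x V.∷ f) ≋? t) (x ≈? t F.zero ×-dec f ≋? (t ∘ F.suc)))
                      (⟦⟧-× (x ≈? t F.zero) (f ≋? (t ∘ F.suc)))

sumFin-cong : ∀ n {f g : Fin n → ℕ} → f ≗ g → sumFin n f ≡ sumFin n g
sumFin-cong zero    e = refl
sumFin-cong (suc n) e = cong₂ _+_ (e F.zero) (sumFin-cong n (e ∘ F.suc))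

sumFin-zero : ∀ n → sumFin n (λ _ → 0) ≡ 0
sumFin-zero zero    = refl
sumFin-zero (suc n) = sumFin-zero n

sumFin-mono : ∀ n {f g : Fin n → ℕ} → (∀ i → f i ≤ g i) → sumFin n f ≤ sumFin n g
sumFin-mono zero    le = z≤n
sumFin-mono (suc n) le = +-mono-≤ (le F.zero) (sumFin-mono n (le ∘ F.suc))

sumFin-mono-< : ∀ n {f g : Fin n → ℕ} (i : Fin n) → (∀ l → f l ≤ g l) → f i < g i → sumFin n f < sumFin n g
sumFin-mono-< (suc n) F.zero    le lt = +-mono-<-≤ lt (sumFin-mono n (le ∘ F.suc))
sumFin-mono-< (suc n) (F.suc i) le lt = +-mono-≤-< (le F.zero) (sumFin-mono-< n i (le ∘ F.suc) lt)

sumFin≡sum : ∀ n (f : Fin n → ℕ) → sumFin n f ≡ sum f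
sumFin≡sum zero    f = refl
sumFin≡sum (suc n) f = cong (f F.zero +_) (sumFin≡sum n (f ∘ F.suc))

sumFin-+ : ∀ n (f g : Fin n → ℕ) → sumFin n (λ i → f i + g i) ≡ sumFin n f + sumFin n g
sumFin-+ zero    f g = refl
sumFin-+ (suc n) f g = trans (cong (f F.zero + g F.zero +_) (sumFin-+ n (f ∘ F.suc) (g ∘ F.suc)))
                             (+-interchange (f F.zero) (g F.zero) _ _)

sumFin-permute : ∀ n (f : Fin n → ℕ) (π : Permutation n n) → sumFin n (f ∘ (π ⟨$⟩ʳ_)) ≡ sumFin n f
sumFin-permute n f π = begin
  sumFin n (f ∘ (π ⟨$⟩ʳ_)) ≡⟨ sumFin≡sum n _ ⟩
  sum (f ∘ (π ⟨$⟩ʳ_))      ≡⟨ ∑-permute f π ⟨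
  sum f                    ≡⟨ sumFin≡sum n f ⟨
  sumFin n f               ∎
  where open ≡-Reasoning

δ : ∀ {n} → Fin n → Fin n → ℕ
δ i l = ⟦ l ≟ᶠ i ⟧

δ-≢ : ∀ {n} (i l : Fin n) → l ≢ i → δ i l ≡ 0
δ-≢ i l = ⟦⟧-no (l ≟ᶠ i)

sumFin-δ* : ∀ n (i : Fin n) (f : Fin n → ℕ) → sumFin n (λ l → δ i l * f l) ≡ f i
sumFin-δ* (suc n) F.zero    f = trans (cong₂ _+_ (*-identityˡ (f F.zero)) (sumFin-zero n)) (+-identityʳ (f F.zero))
sumFin-δ* (suc n) (F.suc i) f = sumFin-δ* n i (f ∘ F.suc)

sumFin-δ : ∀ n (i : Fin n) → sumFin n (δ i) ≡ 1
sumFin-δ n i = trans (sumFin-cong n (λ l → sym (*-identityʳ (δ i l)))) (sumFin-δ* n i (λ _ → 1))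

minimal-counterexample : ∀ {n} (P : Pred (Fin n) 0ℓ) → Decidable P → ¬ (∀ i → P i) →
                         ∃ λ i → ¬ P i × (∀ l → toℕ l < toℕ i → P l)
minimal-counterexample P P? ¬∀P with ¬∀⟶∃¬-smallest _ P P? ¬∀P
... | i , ¬Pi , below = i , ¬Pi , λ l l<i →
  subst P (toℕ-injective (trans (toℕ-inject (fromℕ< l<i)) (toℕ-fromℕ< l<i))) (below (fromℕ< l<i))

prefix : ∀ {n} → (Fin n → ℕ) → ℕ → Fin n → ℕ
prefix v k i = if toℕ i <ᵇ k then v i else 0

module _ {n : ℕ} where

  prefix-< : (v : Fin n → ℕ) {k : ℕ} (i : Fin n) → toℕ i < k → prefix v k i ≡ v i
  prefix-< v {k} i i<k with toℕ i <ᵇ k | <⇒<ᵇ i<k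
  ... | true | _ = refl

  prefix-≥ : (v : Fin n → ℕ) {k : ℕ} (i : Fin n) → k ≤ toℕ i → prefix v k i ≡ 0
  prefix-≥ v {k} i k≤i with toℕ i <ᵇ k | <ᵇ⇒< (toℕ i) k
  ... | true  | i<k = contradiction (i<k _) (≤⇒≯ k≤i)
  ... | false | _   = refl

  prefix-0 : (v : Fin n → ℕ) (k : ℕ) {i : Fin n} → v i ≡ 0 → prefix v k i ≡ 0
  prefix-0 v k {i} vi≡0 with toℕ i <ᵇ k
  ... | true  = vi≡0
  ... | false = refl

  prefix-+ : (v w : Fin n → ℕ) (k : ℕ) (i : Fin n) → prefix (λ l → v l + w l) k i ≡ prefix v k i + prefix w k i
  prefix-+ v w k i with toℕ i <ᵇ k
  ... | true  = refl
  ... | false = refl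

  psum-+ : (v w : Fin n → ℕ) (k : ℕ) → psum (λ l → v l + w l) k ≡ psum v k + psum w k
  psum-+ v w k = trans (sumFin-cong n (prefix-+ v w k)) (sumFin-+ n (prefix v k) (prefix w k))

  psum-zero : (v : Fin n → ℕ) → psum v 0 ≡ 0
  psum-zero v = trans (sumFin-cong n (λ l → prefix-≥ v l z≤n)) (sumFin-zero n)

  psum-total : (v : Fin n → ℕ) {k : ℕ} → n ≤ k → psum v k ≡ sumFin n v
  psum-total v n≤k = sumFin-cong n (λ l → prefix-< v l (<-≤-trans (toℕ<n l) n≤k))

  psum-δ-< : {i : Fin n} {k : ℕ} → toℕ i < k → psum (δ i) k ≡ 1
  psum-δ-< {i} {k} i<k = trans (sumFin-cong n prefix-δ) (sumFin-δ n i)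
    where
    prefix-δ : prefix (δ i) k ≗ δ i
    prefix-δ l with l ≟ᶠ i
    ... | yes refl = prefix-< (λ _ → 1) l i<k
    ... | no  _    = prefix-0 (λ _ → 0) k refl

  psum-δ-≥ : {i : Fin n} {k : ℕ} → k ≤ toℕ i → psum (δ i) k ≡ 0
  psum-δ-≥ {i} {k} k≤i = trans (sumFin-cong n prefix-δ) (sumFin-zero n)
    where
    prefix-δ : prefix (δ i) k ≗ (λ _ → 0)
    prefix-δ l with l ≟ᶠ i
    ... | yes refl = prefix-≥ (λ _ → 1) l k≤i
    ... | no  _    = prefix-0 (λ _ → 0) k refl

  psum-suc : (v : Fin n → ℕ) (i : Fin n) → psum v (suc (toℕ i)) ≡ psum v (toℕ i) + v i
  psum-suc v i = begin
    psum v (suc (toℕ i))                                           ≡⟨ sumFin-cong n split ⟩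
    sumFin n (λ l → prefix v (toℕ i) l + δ i l * v l)               ≡⟨ sumFin-+ n (prefix v (toℕ i)) _ ⟩
    psum v (toℕ i) + sumFin n (λ l → δ i l * v l)                   ≡⟨ cong (psum v (toℕ i) +_) (sumFin-δ* n i v) ⟩
    psum v (toℕ i) + v i                                            ∎
    where
    open ≡-Reasoning
    split : ∀ l → prefix v (suc (toℕ i)) l ≡ prefix v (toℕ i) l + δ i l * v l
    split l with <-cmp (toℕ l) (toℕ i)
    ... | tri< l<i _ _ = begin
      prefix v (suc (toℕ i)) l       ≡⟨ prefix-< v l (m<n⇒m<1+n l<i) ⟩
      v l                            ≡⟨ +-identityʳ (v l) ⟨
      v l + 0                        ≡⟨ cong₂ _+_ (prefix-< v l l<i) (cong (_* v l) (δ-≢ i l (λ { refl → <-irrefl refl l<i }))) ⟨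
      prefix v (toℕ i) l + δ i l * v l ∎
    ... | tri≈ _ l≡i _ rewrite toℕ-injective l≡i | ⟦⟧-yes (i ≟ᶠ i) refl =
      trans (prefix-< v i (n<1+n (toℕ i))) (sym (cong₂ _+_ (prefix-≥ v i ≤-refl) (+-identityʳ (v i))))
    ... | tri> _ _ i<l = trans (prefix-≥ v l i<l) (sym (cong₂ _+_ (prefix-≥ v l (<⇒≤ i<l))
                                                        (cong (_* v l) (δ-≢ i l (λ { refl → <-irrefl refl i<l })))))

record Transfer {n : ℕ} (i j : Fin n) (c c′ : Fin n → ℕ) : Set where
  field
    source : c i ≡ suc (c′ i)
    target : c′ j ≡ suc (c j)
    others : ∀ l → l ≢ i → l ≢ j → c′ l ≡ c l

module _ {n : ℕ} {i j : Fin n} {c c′ : Fin n → ℕ} (i≢j : i ≢ j) (t : Transfer i j c c′) where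
  open Transfer t

  transfer-balance : (λ l → c l + δ j l) ≗ (λ l → c′ l + δ i l)
  transfer-balance l with l ≟ᶠ i | l ≟ᶠ j
  ... | yes refl | yes refl = contradiction refl i≢j
  ... | yes refl | no _     = trans (+-identityʳ (c l)) (trans source (sym (+-comm (c′ l) 1)))
  ... | no _     | yes refl = trans (+-comm (c l) 1) (trans (sym target) (sym (+-identityʳ (c′ l))))
  ... | no l≢i   | no l≢j   = cong (_+ 0) (sym (others l l≢i l≢j))

  transfer-sumFin : sumFin n c ≡ sumFin n c′
  transfer-sumFin = +-cancelʳ-≡ 1 (sumFin n c) (sumFin n c′) (begin
    sumFin n c + 1                      ≡⟨ cong (sumFin n c +_) (sumFin-δ n j) ⟨
    sumFin n c + sumFin n (δ j)         ≡⟨ sumFin-+ n c (δ j) ⟨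
    sumFin n (λ l → c l + δ j l)        ≡⟨ sumFin-cong n transfer-balance ⟩
    sumFin n (λ l → c′ l + δ i l)       ≡⟨ sumFin-+ n c′ (δ i) ⟩
    sumFin n c′ + sumFin n (δ i)        ≡⟨ cong (sumFin n c′ +_) (sumFin-δ n i) ⟩
    sumFin n c′ + 1                     ∎)
    where open ≡-Reasoning

  transfer-psum : ∀ k → psum c k + psum (δ j) k ≡ psum c′ k + psum (δ i) k
  transfer-psum k = begin
    psum c k + psum (δ j) k           ≡⟨ psum-+ c (δ j) k ⟨
    psum (λ l → c l + δ j l) k        ≡⟨ sumFin-cong n (λ l → cong (λ z → if toℕ l <ᵇ k then z else 0) (transfer-balance l)) ⟩
    psum (λ l → c′ l + δ i l) k       ≡⟨ psum-+ c′ (δ i) k ⟩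
    psum c′ k + psum (δ i) k          ∎
    where open ≡-Reasoning

transfer-exists : ∀ {n} {i j : Fin n} (c : Fin n → ℕ) → i ≢ j → c i ≢ 0 → ∃ (Transfer i j c)
transfer-exists {i = i} {j} c i≢j ci≢0 = c′ , record
  { source = sym (trans (cong suc (trans (updateAt-minimal i j _ i≢j) (updateAt-updates i c))) (suc-pred (c i) {{≢-nonZero ci≢0}}))
  ; target = trans (updateAt-updates j _) (cong suc (updateAt-minimal j i c (i≢j ∘ sym)))
  ; others = λ l l≢i l≢j → trans (updateAt-minimal l j _ l≢j) (updateAt-minimal l i c l≢i)
  }
  where
  c′ : Fin _ → ℕ
  c′ = updateAt (updateAt c i pred) j suc

-- A transfer of column demand may leave both counts zero, so strictness only holds in this weak form.
infix 4 _<₀_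
_<₀_ : ℕ → ℕ → Set
u <₀ v = u ≡ 0 ⊎ u < v

<₀⇒≤ : ∀ {u v} → u <₀ v → u ≤ v
<₀⇒≤ (inj₁ refl) = z≤n
<₀⇒≤ (inj₂ u<v)  = <⇒≤ u<v

<₀-trans : ∀ {u v w} → u <₀ v → v <₀ w → u <₀ w
<₀-trans (inj₁ u≡0) _           = inj₁ u≡0
<₀-trans (inj₂ u<v) (inj₁ refl) = contradiction u<v n≮0
<₀-trans (inj₂ u<v) (inj₂ v<w)  = inj₂ (<-trans u<v v<w)

<₀-pos⇒< : ∀ {u v} → u <₀ v → 0 < u → u < v
<₀-pos⇒< (inj₁ refl) ()
<₀-pos⇒< (inj₂ u<v)  _ = u<v

+-mono-<₀ : ∀ {u v u′ v′} → u <₀ v → u′ <₀ v′ → u + u′ <₀ v + v′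
+-mono-<₀ (inj₁ refl) (inj₁ refl)  = inj₁ refl
+-mono-<₀ {v = v} (inj₁ refl) (inj₂ u′<v′) = inj₂ (≤-trans u′<v′ (m≤n+m _ v))
+-mono-<₀ (inj₂ u<v)  (inj₁ refl)  = inj₂ (+-mono-<-≤ u<v z≤n)
+-mono-<₀ (inj₂ u<v)  (inj₂ u′<v′) = inj₂ (+-mono-< u<v u′<v′)

<₀-≤-+ : ∀ {u v w} → u <₀ v → v ≤ w → v + u <₀ w + v
<₀-≤-+ {v = zero}      (inj₁ refl) _   = inj₁ refl
<₀-≤-+ {v = suc v} {w} (inj₁ refl) v≤w =
  inj₂ (subst (_< w + suc v) (sym (+-identityʳ (suc v))) (m<n+m (suc v) (<-≤-trans z<s v≤w)))
<₀-≤-+ (inj₂ u<v) v≤w = inj₂ (+-mono-≤-< v≤w u<v)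

*-monoʳ-<₀ : ∀ k {u v} → u <₀ v → k * u <₀ k * v
*-monoʳ-<₀ k (inj₁ refl) = inj₁ (*-zeroʳ k)
*-monoʳ-<₀ zero    (inj₂ _)   = inj₁ refl
*-monoʳ-<₀ (suc k) (inj₂ u<v) = inj₂ (*-monoʳ-< (suc k) u<v)

<₀-halve : ∀ {u v} → u + u <₀ v + v → u <₀ v
<₀-halve {u} (inj₁ u+u≡0) = inj₁ (m+n≡0⇒m≡0 u u+u≡0)
<₀-halve {u} {v} (inj₂ lt) = inj₂ (≰⇒> λ v≤u → <⇒≱ lt (+-mono-≤ v≤u v≤u))

sumL-mono-<₀ : {A : Set} (xs : List A) {h g : A → ℕ} → (∀ x → h x <₀ g x) → sumL xs h <₀ sumL xs g
sumL-mono-<₀ []       _  = inj₁ refl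
sumL-mono-<₀ (x ∷ xs) hg = +-mono-<₀ (hg x) (sumL-mono-<₀ xs hg)

≺⇒psum≤ : ∀ {n} {a c : Fin n → ℕ} → a ≺ c → ∀ k → psum a k ≤ psum c k
≺⇒psum≤ {n} {a} {c} (inner , total) k with k ≟ 0 | k <? n
... | yes refl | _   = ≤-reflexive (trans (psum-zero a) (sym (psum-zero c)))
... | no k≢0   | yes k<n = inner k (n≢0⇒n>0 k≢0) k<n
... | no _     | no k≮n  = ≤-reflexive (trans (psum-total a (≮⇒≥ k≮n)) (trans total (sym (psum-total c (≮⇒≥ k≮n)))))

module Majorization {n : ℕ} (a : Fin n → ℕ) (a-nonincreasing : Nonincreasing a)
  (Φ : (Fin n → ℕ) → ℕ) (Φ-cong : ∀ {c c′} → c ≗ c′ → Φ c ≡ Φ c′)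
  (Φ-transfer : ∀ {i j c c′} → i ≢ j → Transfer i j c c′ → c′ j ≤ c′ i → Φ c <₀ Φ c′) where

  Dominates : (Fin n → ℕ) → Set
  Dominates c = (∀ k → psum a k ≤ psum c k) × sumFin n a ≡ sumFin n c

  excess : (Fin n → ℕ) → ℕ
  excess c = sumFin n (λ l → c l ∸ a l)

  first-difference-< : ∀ {c} → Dominates c → (i : Fin n) → a i ≢ c i → (∀ l → toℕ l < toℕ i → a l ≡ c l) → a i < c i
  first-difference-< {c} (prefix-≤ , _) i ai≢ci equal-before = ≤∧≢⇒< (+-cancelˡ-≤ (psum c (toℕ i)) (a i) (c i) (begin
    psum c (toℕ i) + a i   ≡⟨ cong (_+ a i) same-prefix ⟨
    psum a (toℕ i) + a i   ≡⟨ psum-suc a i ⟨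
    psum a (suc (toℕ i))   ≤⟨ prefix-≤ (suc (toℕ i)) ⟩
    psum c (suc (toℕ i))   ≡⟨ psum-suc c i ⟩
    psum c (toℕ i) + c i   ∎)) ai≢ci
    where
    open ≤-Reasoning
    same-prefix : psum a (toℕ i) ≡ psum c (toℕ i)
    same-prefix = sumFin-cong n λ l → case (toℕ l <? toℕ i)
      where
      case : ∀ {l} → Dec (toℕ l < toℕ i) → prefix a (toℕ i) l ≡ prefix c (toℕ i) l
      case {l} (yes l<i) = trans (prefix-< a l l<i) (trans (equal-before l l<i) (sym (prefix-< c l l<i)))
      case {l} (no l≮i)  = trans (prefix-≥ a l (≮⇒≥ l≮i)) (sym (prefix-≥ c l (≮⇒≥ l≮i)))

  first-deficit : ∀ {c} → Dominates c → (i : Fin n) → a i < c i → (∀ l → toℕ l < toℕ i → a l ≡ c l) →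
                  ∃ λ j → c j < a j × toℕ i < toℕ j × (∀ l → toℕ l < toℕ j → a l ≤ c l)
  first-deficit {c} (_ , total) i ai<ci equal-before with minimal-counterexample (λ l → a l ≤ c l) (λ l → a l ≤? c l) not-all
    where
    not-all : ¬ (∀ l → a l ≤ c l)
    not-all a≤c = <-irrefl total (sumFin-mono-< n i a≤c ai<ci)
  ... | j , aj≰cj , below-j = j , ≰⇒> aj≰cj , ≰⇒> j≤i-absurd , below-j
    where
    j≤i-absurd : ¬ (toℕ j ≤ toℕ i)
    j≤i-absurd j≤i with m≤n⇒m<n∨m≡n j≤i
    ... | inj₁ j<i = aj≰cj (≤-reflexive (equal-before j j<i))
    ... | inj₂ j≡i rewrite toℕ-injective j≡i = aj≰cj (<⇒≤ ai<ci)

  module Step {c c′ : Fin n → ℕ} {i j : Fin n} (dom : Dominates c) (i<j : toℕ i < toℕ j)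
              (ai<ci : a i < c i) (cj<aj : c j < a j) (below-j : ∀ l → toℕ l < toℕ j → a l ≤ c l)
              (t : Transfer i j c c′) where
    open Transfer t

    i≢j : i ≢ j
    i≢j i≡j = <-irrefl (cong toℕ i≡j) i<j

    ai≤c′i : a i ≤ c′ i
    ai≤c′i = s≤s⁻¹ (subst (a i <_) source ai<ci)

    c′j≤aj : c′ j ≤ a j
    c′j≤aj = subst (_≤ a j) (sym target) cj<aj

    balance-at : ∀ k {u v} → psum (δ j) k ≡ u → psum (δ i) k ≡ v → psum c k + u ≡ psum c′ k + v
    balance-at k refl refl = transfer-psum i≢j t k

    prefix-strict : ∀ k → toℕ i < k → k ≤ toℕ j → psum a k < psum c k
    prefix-strict k i<k k≤j = sumFin-mono-< n i pointwise (subst₂ _<_ (sym (prefix-< a i i<k)) (sym (prefix-< c i i<k)) ai<ci)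
      where
      pointwise : ∀ l → prefix a k l ≤ prefix c k l
      pointwise l with toℕ l <? k
      ... | yes l<k = subst₂ _≤_ (sym (prefix-< a l l<k)) (sym (prefix-< c l l<k)) (below-j l (<-≤-trans l<k k≤j))
      ... | no  l≮k = ≤-reflexive (trans (prefix-≥ a l (≮⇒≥ l≮k)) (sym (prefix-≥ c l (≮⇒≥ l≮k))))

    dominates : Dominates c′
    dominates = prefix-≤′ , trans (proj₂ dom) (transfer-sumFin i≢j t)
      where
      prefix-≤′ : ∀ k → psum a k ≤ psum c′ k
      prefix-≤′ k with toℕ i <? k | toℕ j <? k
      ... | yes i<k | yes j<k = subst (psum a k ≤_) (+-cancelʳ-≡ 1 _ _ (balance-at k (psum-δ-< j<k) (psum-δ-< i<k))) (proj₁ dom k)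
      ... | no  i≮k | no  j≮k = subst (psum a k ≤_) (+-cancelʳ-≡ 0 _ _ (balance-at k (psum-δ-≥ (≮⇒≥ j≮k)) (psum-δ-≥ (≮⇒≥ i≮k))))
                                      (proj₁ dom k)
      ... | no  i≮k | yes j<k = contradiction (<-trans i<j j<k) i≮k
      ... | yes i<k | no  j≮k = s≤s⁻¹ (subst (psum a k <_) drop (prefix-strict k i<k (≮⇒≥ j≮k)))
        where
        drop : psum c k ≡ suc (psum c′ k)
        drop = trans (sym (+-identityʳ _)) (trans (balance-at k (psum-δ-≥ (≮⇒≥ j≮k)) (psum-δ-< i<k)) (+-comm _ 1))

    excess-decreases : excess c′ < excess c
    excess-decreases = sumFin-mono-< n i pointwise at-i
      where
      at-i : c′ i ∸ a i < c i ∸ a i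
      at-i = subst (λ v → c′ i ∸ a i < v ∸ a i) (sym source) (∸-monoˡ-< (n<1+n (c′ i)) ai≤c′i)
      pointwise : ∀ l → c′ l ∸ a l ≤ c l ∸ a l
      pointwise l with l ≟ᶠ i | l ≟ᶠ j
      ... | yes refl | _        = <⇒≤ at-i
      ... | no _     | yes refl = ≤-trans (≤-reflexive (m≤n⇒m∸n≡0 c′j≤aj)) z≤n
      ... | no l≢i   | no l≢j   = ≤-reflexive (cong (_∸ a l) (others l l≢i l≢j))

    Φ-increases : Φ c <₀ Φ c′
    Φ-increases = Φ-transfer i≢j t (begin
      c′ j  ≤⟨ c′j≤aj ⟩
      a j   ≤⟨ a-nonincreasing i j (<⇒≤ i<j) ⟩
      a i   ≤⟨ ai≤c′i ⟩
      c′ i  ∎)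
      where open ≤-Reasoning

  step : ∀ {c} → Dominates c → ¬ (∀ l → a l ≡ c l) → ∃ λ c′ → Dominates c′ × excess c′ < excess c × Φ c <₀ Φ c′
  step {c} dom a≢c with minimal-counterexample (λ l → a l ≡ c l) (λ l → a l ≟ c l) a≢c
  ... | i , ai≢ci , equal-before with first-difference-< dom i ai≢ci equal-before
  ... | ai<ci with first-deficit dom i ai<ci equal-before
  ... | j , cj<aj , i<j , below-j with transfer-exists c (λ i≡j → <-irrefl (cong toℕ i≡j) i<j) (m<n⇒n≢0 ai<ci)
  ... | c′ , t = c′ , dominates , excess-decreases , Φ-increases
    where open Step dom i<j ai<ci cj<aj below-j t

  descent : ∀ {c} → Acc _<_ (excess c) → Dominates c → (∀ l → a l ≡ c l) ⊎ Φ c <₀ Φ a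
  descent {c} (acc rec) dom with all? (λ l → a l ≟ c l)
  ... | yes a≗c = inj₁ a≗c
  ... | no  a≢c = continue (step dom a≢c)
    where
    continue : (∃ λ c′ → Dominates c′ × excess c′ < excess c × Φ c <₀ Φ c′) → (∀ l → a l ≡ c l) ⊎ Φ c <₀ Φ a
    continue (c′ , dom′ , smaller , Φc<₀Φc′) = inj₂ ([ (λ a≗c′ → subst (Φ c <₀_) (Φ-cong (sym ∘ a≗c′)) Φc<₀Φc′)
                                                     , <₀-trans Φc<₀Φc′ ]′ (descent (rec smaller) dom′))

  majorization-descent : ∀ {c} → a ≺ c → ¬ (∀ l → a l ≡ c l) → Φ c <₀ Φ a
  majorization-descent {c} a≺c a≢c =
    [ (λ a≗c → contradiction a≗c a≢c) , id ]′ (descent (<-wellFounded (excess c)) (≺⇒psum≤ a≺c , proj₂ a≺c))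

withdraw : Bool → (ℕ → ℕ) → ℕ → ℕ
withdraw false f p       = f p
withdraw true  f zero    = 0
withdraw true  f (suc p) = f p

withdraw-spec : ∀ α (f : ℕ → ℕ) p → ⟦ b2n α ≤? p ⟧ * f (p ∸ b2n α) ≡ withdraw α f p
withdraw-spec false f p       = +-identityʳ (f p)
withdraw-spec true  f zero    = refl
withdraw-spec true  f (suc p) = +-identityʳ (f p)

withdraw-cong : ∀ α {f g : ℕ → ℕ} → f ≗ g → ∀ p → withdraw α f p ≡ withdraw α g p
withdraw-cong false f≗g p       = f≗g p
withdraw-cong true  f≗g zero    = refl
withdraw-cong true  f≗g (suc p) = f≗g p

-- The contribution of a first row with entries α, β in two distinguished columns of remaining demand p, q:
-- zero if the row does not fit, and otherwise G of the reduced demands.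
withdraw₂ : Bool → Bool → (ℕ → ℕ → ℕ) → ℕ → ℕ → ℕ
withdraw₂ α β G p q = withdraw α (λ p′ → withdraw β (G p′) q) p

withdraw₂-spec : ∀ α β (G : ℕ → ℕ → ℕ) p q →
  ⟦ b2n α ≤? p ⟧ * (⟦ b2n β ≤? q ⟧ * G (p ∸ b2n α) (q ∸ b2n β)) ≡ withdraw₂ α β G p q
withdraw₂-spec α β G p q =
  trans (cong (⟦ b2n α ≤? p ⟧ *_) (withdraw-spec β (G (p ∸ b2n α)) q)) (withdraw-spec α (λ p′ → withdraw β (G p′) q) p)

withdraw₂-cong : ∀ α β {G H : ℕ → ℕ → ℕ} → (∀ p q → G p q ≡ H p q) → ∀ p q → withdraw₂ α β G p q ≡ withdraw₂ α β H p q
withdraw₂-cong α β G≡H p q = withdraw-cong α (λ p′ → withdraw-cong β (G≡H p′) q) p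

mirrored : (ℕ → ℕ → ℕ) → Bool → Bool → ℕ → ℕ → ℕ
mirrored G α β p q = withdraw₂ α β G p q + withdraw₂ β α G p q

module Balancing (G : ℕ → ℕ → ℕ) (G-sym : ∀ p q → G p q ≡ G q p)
                 (G-balance : ∀ {p q} → q < p → G (suc p) q <₀ G p (suc q)) where

  G-balance-≤ : ∀ {p q} → q ≤ p → G (suc p) q ≤ G p (suc q)
  G-balance-≤ q≤p with m≤n⇒m<n∨m≡n q≤p
  ... | inj₁ q<p  = <₀⇒≤ (G-balance q<p)
  ... | inj₂ refl = ≤-reflexive (G-sym _ _)

  mixed-balance : ∀ {p q} → q < p → withdraw₂ true false G (suc p) q + withdraw₂ false true G (suc p) q
                                      <₀ withdraw₂ true false G p (suc q) + withdraw₂ false true G p (suc q)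
  mixed-balance {suc p} {zero}  _   = <₀-≤-+ (inj₁ refl) (G-balance-≤ z≤n)
  mixed-balance {suc p} {suc q} q<p = <₀-≤-+ (G-balance (m<n⇒m<1+n (s≤s⁻¹ q<p))) (G-balance-≤ (s≤s⁻¹ q<p))

  mirrored-balance : ∀ α β {p q} → q < p → mirrored G α β (suc p) q <₀ mirrored G α β p (suc q)
  mirrored-balance false false         q<p = +-mono-<₀ (G-balance q<p) (G-balance q<p)
  mirrored-balance true  true  {suc p} {zero}  _   = inj₁ refl
  mirrored-balance true  true  {suc p} {suc q} q<p = +-mono-<₀ (G-balance (s≤s⁻¹ q<p)) (G-balance (s≤s⁻¹ q<p))
  mirrored-balance true  false         q<p = mixed-balance q<p
  mirrored-balance false true  {p} {q} q<p =
    subst₂ _<₀_ (+-comm (withdraw₂ true false G (suc p) q) _) (+-comm (withdraw₂ true false G p (suc q)) _) (mixed-balance q<p)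

module Realizations (n : ℕ) where

  Row : Set
  Row = Fin n → Bool

  rowEnumeration : Enumeration (Pointwise.decSetoid Bool-decSetoid n)
  rowEnumeration = funEnumeration boolEnumeration n

  open Enumeration rowEnumeration using () renaming (elements to rows)

  weight : Row → ℕ
  weight r = sumFin n (λ j → b2n (r j))

  Fits : Row → (Fin n → ℕ) → Set
  Fits r c = ∀ j → b2n (r j) ≤ c j

  fits? : (r : Row) (c : Fin n → ℕ) → Dec (Fits r c)
  fits? r c = all? (λ j → b2n (r j) ≤? c j)

  _⊖_ : (Fin n → ℕ) → Row → Fin n → ℕ
  (c ⊖ r) j = c j ∸ b2n (r j)

  zero? : (c : Fin n → ℕ) → Dec (∀ j → c j ≡ 0)
  zero? c = all? (λ j → c j ≟ 0)

  count : (m : ℕ) → (Fin m → ℕ) → (Fin n → ℕ) → ℕ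
  firstRow : (m : ℕ) → (Fin (suc m) → ℕ) → (Fin n → ℕ) → Row → ℕ

  count zero    b c = ⟦ zero? c ⟧
  count (suc m) b c = sumL rows (firstRow m b c)

  firstRow m b c r = ⟦ weight r ≟ b F.zero ⟧ * (⟦ fits? r c ⟧ * count m (b ∘ F.suc) (c ⊖ r))

  count-cong : ∀ m b {c c′} → c ≗ c′ → count m b c ≡ count m b c′
  count-cong zero    b {c} {c′} c≗c′ =
    ⟦⟧-cong (λ H j → trans (sym (c≗c′ j)) (H j)) (λ H j → trans (c≗c′ j) (H j)) (zero? c) (zero? c′)
  count-cong (suc m) b {c} {c′} c≗c′ = sumL-cong rows λ r →
    cong₂ (λ u v → ⟦ weight r ≟ b F.zero ⟧ * (u * v))
          (⟦⟧-cong (λ H j → subst (b2n (r j) ≤_) (c≗c′ j) (H j)) (λ H j → subst (b2n (r j) ≤_) (sym (c≗c′ j)) (H j))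
                   (fits? r c) (fits? r c′))
          (count-cong m (b ∘ F.suc) (λ j → cong (_∸ b2n (r j)) (c≗c′ j)))

  firstRow-resp : ∀ m b c {r r′} → r ≗ r′ → firstRow m b c r ≡ firstRow m b c r′
  firstRow-resp m b c {r} {r′} r≗r′ =
    cong₂ _*_ (cong (λ w → ⟦ w ≟ b F.zero ⟧) (sumFin-cong n (cong b2n ∘ r≗r′)))
              (cong₂ _*_ (⟦⟧-cong (λ H j → subst (λ x → b2n x ≤ c j) (r≗r′ j) (H j))
                                  (λ H j → subst (λ x → b2n x ≤ c j) (sym (r≗r′ j)) (H j))
                                  (fits? r c) (fits? r′ c))
                         (count-cong m _ (λ j → cong (λ x → c j ∸ b2n x) (r≗r′ j))))

  Realizes : (m : ℕ) → (Fin m → ℕ) → (Fin n → ℕ) → (Fin m → Row) → Set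
  Realizes m b c M = (∀ i → weight (M i) ≡ b i) × (∀ j → sumFin m (λ i → b2n (M i j)) ≡ c j)

  realizes? : ∀ m b c (M : Fin m → Row) → Dec (Realizes m b c M)
  realizes? m b c M = all? (λ i → weight (M i) ≟ b i) ×-dec all? (λ j → sumFin m (λ i → b2n (M i j)) ≟ c j)

  realizes-cong : ∀ m b c {M M′ : Fin m → Row} → (∀ i j → M i j ≡ M′ i j) → ⟦ realizes? m b c M ⟧ ≡ ⟦ realizes? m b c M′ ⟧
  realizes-cong m b c {M} {M′} M≈M′ =
    ⟦⟧-cong (move M≈M′) (move (λ i j → sym (M≈M′ i j))) (realizes? m b c M) (realizes? m b c M′)
    where
    move : ∀ {M M′ : Fin m → Row} → (∀ i j → M i j ≡ M′ i j) → Realizes m b c M → Realizes m b c M′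
    move M≈M′ (rows-ok , cols-ok) = (λ i → trans (sumFin-cong n (λ j → cong b2n (sym (M≈M′ i j)))) (rows-ok i))
                                  , (λ j → trans (sumFin-cong m (λ i → cong b2n (sym (M≈M′ i j)))) (cols-ok j))

  realizes-first-row : ∀ m b c r (M : Fin m → Row) →
    Realizes (suc m) b c (r V.∷ M) ⇔ (weight r ≡ b F.zero × Fits r c × Realizes m (b ∘ F.suc) (c ⊖ r) M)
  realizes-first-row m b c r M = mk⇔
    (λ (rows-ok , cols-ok) → rows-ok F.zero
                           , (λ j → subst (b2n (r j) ≤_) (cols-ok j) (m≤m+n (b2n (r j)) _))
                           , rows-ok ∘ F.suc
                           , (λ j → sym (trans (cong (_∸ b2n (r j)) (sym (cols-ok j))) (m+n∸m≡n (b2n (r j)) _))))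
    (λ (first-ok , fits , rows-ok , cols-ok) → (λ { F.zero → first-ok ; (F.suc i) → rows-ok i })
                                            , (λ j → trans (cong (b2n (r j) +_) (cols-ok j)) (m+[n∸m]≡n (fits j))))

  realizes?-first-row : ∀ m b c r (M : Fin m → Row) →
    ⟦ realizes? (suc m) b c (r V.∷ M) ⟧ ≡ ⟦ weight r ≟ b F.zero ⟧ * (⟦ fits? r c ⟧ * ⟦ realizes? m (b ∘ F.suc) (c ⊖ r) M ⟧)
  realizes?-first-row m b c r M = begin
    ⟦ realizes? (suc m) b c (r V.∷ M) ⟧
      ≡⟨ ⟦⟧-cong (to (realizes-first-row m b c r M)) (from (realizes-first-row m b c r M)) (realizes? (suc m) b c (r V.∷ M))
                 (weight r ≟ b F.zero ×-dec (fits? r c ×-dec realizes? m b′ (c ⊖ r) M)) ⟩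
    ⟦ weight r ≟ b F.zero ×-dec (fits? r c ×-dec realizes? m b′ (c ⊖ r) M) ⟧
      ≡⟨ ⟦⟧-× (weight r ≟ b F.zero) (fits? r c ×-dec realizes? m b′ (c ⊖ r) M) ⟩
    ⟦ weight r ≟ b F.zero ⟧ * ⟦ fits? r c ×-dec realizes? m b′ (c ⊖ r) M ⟧
      ≡⟨ cong (⟦ weight r ≟ b F.zero ⟧ *_) (⟦⟧-× (fits? r c) (realizes? m b′ (c ⊖ r) M)) ⟩
    ⟦ weight r ≟ b F.zero ⟧ * (⟦ fits? r c ⟧ * ⟦ realizes? m b′ (c ⊖ r) M ⟧) ∎
    where
    open ≡-Reasoning
    b′ : Fin m → ℕ
    b′ = b ∘ F.suc

  count-realizations : ∀ m b c → sumL (allFuns m rows) (λ M → ⟦ realizes? m b c M ⟧) ≡ count m b c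
  count-realizations zero b c =
    trans (sumL-cong (allFuns 0 rows) λ M → ⟦⟧-cong (λ (_ , cols-ok) j → sym (cols-ok j)) (λ c≡0 → (λ ()) , λ j → sym (c≡0 j))
                                                    (realizes? 0 b c M) (zero? c))
          (+-identityʳ _)
  count-realizations (suc m) b c = begin
    sumL (allFuns (suc m) rows) (λ M → ⟦ realizes? (suc m) b c M ⟧)
      ≡⟨ sumL-allFuns-suc m rows _ (λ M≗M′ → realizes-cong (suc m) b c (cong-app ∘ M≗M′)) ⟩
    sumL rows (λ r → sumL (allFuns m rows) (λ M → ⟦ realizes? (suc m) b c (r V.∷ M) ⟧))
      ≡⟨ sumL-cong rows (λ r → sumL-cong (allFuns m rows) (realizes?-first-row m b c r)) ⟩
    sumL rows (λ r → sumL (allFuns m rows) (λ M → ⟦ weight r ≟ b F.zero ⟧ * (⟦ fits? r c ⟧ * ⟦ realizes? m b′ (c ⊖ r) M ⟧)))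
      ≡⟨ sumL-cong rows factor ⟩
    count (suc m) b c ∎
    where
    open ≡-Reasoning
    b′ : Fin m → ℕ
    b′ = b ∘ F.suc
    factor : ∀ r → sumL (allFuns m rows) (λ M → ⟦ weight r ≟ b F.zero ⟧ * (⟦ fits? r c ⟧ * ⟦ realizes? m b′ (c ⊖ r) M ⟧))
                 ≡ firstRow m b c r
    factor r = begin
      sumL (allFuns m rows) (λ M → ⟦ weight r ≟ b F.zero ⟧ * (⟦ fits? r c ⟧ * ⟦ realizes? m b′ (c ⊖ r) M ⟧))
        ≡⟨ sumL-*ˡ (allFuns m rows) ⟦ weight r ≟ b F.zero ⟧ _ ⟩
      ⟦ weight r ≟ b F.zero ⟧ * sumL (allFuns m rows) (λ M → ⟦ fits? r c ⟧ * ⟦ realizes? m b′ (c ⊖ r) M ⟧)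
        ≡⟨ cong (⟦ weight r ≟ b F.zero ⟧ *_) (sumL-*ˡ (allFuns m rows) ⟦ fits? r c ⟧ _) ⟩
      ⟦ weight r ≟ b F.zero ⟧ * (⟦ fits? r c ⟧ * sumL (allFuns m rows) (λ M → ⟦ realizes? m b′ (c ⊖ r) M ⟧))
        ≡⟨ cong (λ k → ⟦ weight r ≟ b F.zero ⟧ * (⟦ fits? r c ⟧ * k)) (count-realizations m b′ (c ⊖ r)) ⟩
      firstRow m b c r ∎

  -- isRealization? a b is definitionally realizes? n b a.
  N₁≡count : (a b : Fin n → ℕ) → N₁ a b ≡ count n b a
  N₁≡count a b = trans (length-filter-sumL (isRealization? a b) (allMatrices n)) (count-realizations n b a)

  N₁-pos : (a b : Fin n → ℕ) → LoopDigraphic a b → 0 < N₁ a b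
  N₁-pos a b (M , M-realizes) = begin-strict
    0                                                   <⟨ s≤s z≤n ⟩
    1                                                   ≡⟨ ⟦⟧-yes (isRealization? a b M) M-realizes ⟨
    ⟦ isRealization? a b M ⟧                             ≤⟨ term≤sumL (λ M → ⟦ isRealization? a b M ⟧) (realizes-cong n b a) M ⟩
    sumL (allMatrices n) (λ M → ⟦ isRealization? a b M ⟧) ≡⟨ length-filter-sumL (isRealization? a b) (allMatrices n) ⟨
    N₁ a b                                              ∎
    where
    open ≤-Reasoning
    open Enumeration (funEnumeration rowEnumeration n) using (term≤sumL)

  sumL-rows-permute : (π : Permutation n n) (h : Row → ℕ) → (∀ {r r′} → r ≗ r′ → h r ≡ h r′) →
                      sumL rows (λ r → h (r ∘ (π ⟨$⟩ʳ_))) ≡ sumL rows h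
  sumL-rows-permute π h h-resp = sumL-reindex h h-resp (_∘ (π ⟨$⟩ʳ_)) (_∘ (π ⟨$⟩ˡ_))
    (λ {r} s≈rπ j → trans (cong r (sym (inverseʳ π))) (sym (s≈rπ (π ⟨$⟩ˡ j))))
    (λ {r} {s} r≈sπ⁻¹ j → trans (cong s (sym (inverseˡ π))) (sym (r≈sπ⁻¹ (π ⟨$⟩ʳ j))))
    where open Enumeration rowEnumeration using (sumL-reindex)

  count-permute : (π : Permutation n n) → ∀ m b c → count m b (c ∘ (π ⟨$⟩ʳ_)) ≡ count m b c
  count-permute π zero b c =
    ⟦⟧-cong (λ H j → subst (λ k → c k ≡ 0) (inverseʳ π) (H (π ⟨$⟩ˡ j))) (λ H j → H (π ⟨$⟩ʳ j))
            (zero? (c ∘ (π ⟨$⟩ʳ_))) (zero? c)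
  count-permute π (suc m) b c = begin
    sumL rows (firstRow m b cπ)                        ≡⟨ sumL-rows-permute π (firstRow m b cπ) (firstRow-resp m b cπ) ⟨
    sumL rows (λ r → firstRow m b cπ (r ∘ (π ⟨$⟩ʳ_)))  ≡⟨ sumL-cong rows permuted-row ⟩
    sumL rows (firstRow m b c)                         ∎
    where
    open ≡-Reasoning
    cπ : Fin n → ℕ
    cπ = c ∘ (π ⟨$⟩ʳ_)
    permuted-row : ∀ r → firstRow m b cπ (r ∘ (π ⟨$⟩ʳ_)) ≡ firstRow m b c r
    permuted-row r =
      cong₂ _*_ (cong (λ w → ⟦ w ≟ b F.zero ⟧) (sumFin-permute n (λ j → b2n (r j)) π))
                (cong₂ _*_ (⟦⟧-cong (λ H j → subst (λ k → b2n (r k) ≤ c k) (inverseʳ π) (H (π ⟨$⟩ˡ j))) (λ H j → H (π ⟨$⟩ʳ j))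
                                    (fits? (r ∘ (π ⟨$⟩ʳ_)) cπ) (fits? r c))
                           (count-permute π m (b ∘ F.suc) (c ⊖ r)))

  module TwoColumns (x y : Fin n) (x≢y : x ≢ y) where

    set : (Fin n → ℕ) → ℕ → ℕ → Fin n → ℕ
    set c p q = updateAt (updateAt c x (const p)) y (const q)

    set-x : ∀ c p q → set c p q x ≡ p
    set-x c p q = trans (updateAt-minimal x y _ x≢y) (updateAt-updates x c)

    set-y : ∀ c p q → set c p q y ≡ q
    set-y c p q = updateAt-updates y _

    set-other : ∀ c p q {l} → l ≢ x → l ≢ y → set c p q l ≡ c l
    set-other c p q {l} l≢x l≢y = trans (updateAt-minimal l y _ l≢y) (updateAt-minimal l x c l≢x)

    by-cases : {P : Fin n → Set} → P x → P y → (∀ l → l ≢ x → l ≢ y → P l) → ∀ l → P l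
    by-cases at-x at-y elsewhere l with l ≟ᶠ x | l ≟ᶠ y
    ... | yes refl | _        = at-x
    ... | no _     | yes refl = at-y
    ... | no l≢x   | no l≢y   = elsewhere l l≢x l≢y

    agree : {A : Set} {f g : Fin n → A} → f x ≡ g x → f y ≡ g y → (∀ l → l ≢ x → l ≢ y → f l ≡ g l) → f ≗ g
    agree = by-cases

    τ : Permutation n n
    τ = transpose x y

    τ-x : τ ⟨$⟩ʳ x ≡ y
    τ-x rewrite dec-true (x ≟ᶠ x) refl = refl

    τ-y : τ ⟨$⟩ʳ y ≡ x
    τ-y rewrite dec-false (y ≟ᶠ x) (x≢y ∘ sym) | dec-true (y ≟ᶠ y) refl = refl

    τ-other : ∀ {l} → l ≢ x → l ≢ y → τ ⟨$⟩ʳ l ≡ l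
    τ-other {l} l≢x l≢y rewrite dec-false (l ≟ᶠ x) l≢x | dec-false (l ≟ᶠ y) l≢y = refl

    count-set-swap : ∀ m b c p q → count m b (set c p q) ≡ count m b (set c q p)
    count-set-swap m b c p q = trans (sym (count-permute τ m b (set c p q))) (count-cong m b (agree
      (trans (cong (set c p q) τ-x) (trans (set-y c p q) (sym (set-x c q p))))
      (trans (cong (set c p q) τ-y) (trans (set-x c p q) (sym (set-y c q p))))
      (λ l l≢x l≢y → trans (cong (set c p q) (τ-other l≢x l≢y)) (trans (set-other c p q l≢x l≢y) (sym (set-other c q p l≢x l≢y))))))

    FitsElsewhere : Row → (Fin n → ℕ) → Set
    FitsElsewhere r c = ∀ l → l ≢ x → l ≢ y → b2n (r l) ≤ c l

    fitsElsewhere? : (r : Row) (c : Fin n → ℕ) → Dec (FitsElsewhere r c)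
    fitsElsewhere? r c = all? (λ l → ¬? (l ≟ᶠ x) →-dec (¬? (l ≟ᶠ y) →-dec b2n (r l) ≤? c l))

    fits-set : ∀ r c P Q → Fits r (set c P Q) ⇔ (FitsElsewhere r c × b2n (r x) ≤ P × b2n (r y) ≤ Q)
    fits-set r c P Q = mk⇔
      (λ fits → (λ l l≢x l≢y → subst (b2n (r l) ≤_) (set-other c P Q l≢x l≢y) (fits l))
              , subst (b2n (r x) ≤_) (set-x c P Q) (fits x)
              , subst (b2n (r y) ≤_) (set-y c P Q) (fits y))
      (λ (elsewhere , at-x , at-y) → by-cases (subst (b2n (r x) ≤_) (sym (set-x c P Q)) at-x)
                                              (subst (b2n (r y) ≤_) (sym (set-y c P Q)) at-y)
                                              (λ l l≢x l≢y → subst (b2n (r l) ≤_) (sym (set-other c P Q l≢x l≢y)) (elsewhere l l≢x l≢y)))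

    residual : ∀ m → (Fin m → ℕ) → (Fin n → ℕ) → Row → ℕ → ℕ → ℕ
    residual m b c r p q = count m b (set (c ⊖ r) p q)

    firstRow-set : ∀ m b c P Q r → firstRow m b (set c P Q) r
                 ≡ ⟦ weight r ≟ b F.zero ⟧ * (⟦ fitsElsewhere? r c ⟧ * withdraw₂ (r x) (r y) (residual m (b ∘ F.suc) c r) P Q)
    firstRow-set m b c P Q r = cong (⟦ weight r ≟ b F.zero ⟧ *_) (begin
      ⟦ fits? r (set c P Q) ⟧ * count m b′ (set c P Q ⊖ r)
        ≡⟨ cong₂ _*_ fits-split (count-cong m b′ ⊖-set) ⟩
      (⟦ fitsElsewhere? r c ⟧ * (⟦ rx ≤? P ⟧ * ⟦ ry ≤? Q ⟧)) * residual m b′ c r (P ∸ rx) (Q ∸ ry)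
        ≡⟨ *-assoc₄ ⟦ fitsElsewhere? r c ⟧ ⟦ rx ≤? P ⟧ ⟦ ry ≤? Q ⟧ _ ⟩
      ⟦ fitsElsewhere? r c ⟧ * (⟦ rx ≤? P ⟧ * (⟦ ry ≤? Q ⟧ * residual m b′ c r (P ∸ rx) (Q ∸ ry)))
        ≡⟨ cong (⟦ fitsElsewhere? r c ⟧ *_) (withdraw₂-spec (r x) (r y) (residual m b′ c r) P Q) ⟩
      ⟦ fitsElsewhere? r c ⟧ * withdraw₂ (r x) (r y) (residual m b′ c r) P Q ∎)
      where
      open ≡-Reasoning
      b′ : Fin m → ℕ
      b′ = b ∘ F.suc
      rx ry : ℕ
      rx = b2n (r x)
      ry = b2n (r y)
      *-assoc₄ : ∀ a b c d → (a * (b * c)) * d ≡ a * (b * (c * d))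
      *-assoc₄ a b c d = trans (*-assoc a (b * c) d) (cong (a *_) (*-assoc b c d))
      fits-split : ⟦ fits? r (set c P Q) ⟧ ≡ ⟦ fitsElsewhere? r c ⟧ * (⟦ rx ≤? P ⟧ * ⟦ ry ≤? Q ⟧)
      fits-split = begin
        ⟦ fits? r (set c P Q) ⟧
          ≡⟨ ⟦⟧-cong (to (fits-set r c P Q)) (from (fits-set r c P Q)) (fits? r (set c P Q))
                     (fitsElsewhere? r c ×-dec (rx ≤? P ×-dec ry ≤? Q)) ⟩
        ⟦ fitsElsewhere? r c ×-dec (rx ≤? P ×-dec ry ≤? Q) ⟧
          ≡⟨ ⟦⟧-× (fitsElsewhere? r c) (rx ≤? P ×-dec ry ≤? Q) ⟩
        ⟦ fitsElsewhere? r c ⟧ * ⟦ rx ≤? P ×-dec ry ≤? Q ⟧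
          ≡⟨ cong (⟦ fitsElsewhere? r c ⟧ *_) (⟦⟧-× (rx ≤? P) (ry ≤? Q)) ⟩
        ⟦ fitsElsewhere? r c ⟧ * (⟦ rx ≤? P ⟧ * ⟦ ry ≤? Q ⟧) ∎
      ⊖-set : set c P Q ⊖ r ≗ set (c ⊖ r) (P ∸ rx) (Q ∸ ry)
      ⊖-set = agree (trans (cong (_∸ rx) (set-x c P Q)) (sym (set-x (c ⊖ r) _ _)))
                    (trans (cong (_∸ ry) (set-y c P Q)) (sym (set-y (c ⊖ r) _ _)))
                    (λ l l≢x l≢y → trans (cong (_∸ b2n (r l)) (set-other c P Q l≢x l≢y)) (sym (set-other (c ⊖ r) _ _ l≢x l≢y)))

    firstRow-set-mirror : ∀ m b c P Q r → firstRow m b (set c P Q) (r ∘ (τ ⟨$⟩ʳ_))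
                        ≡ ⟦ weight r ≟ b F.zero ⟧ * (⟦ fitsElsewhere? r c ⟧ * withdraw₂ (r y) (r x) (residual m (b ∘ F.suc) c r) P Q)
    firstRow-set-mirror m b c P Q r = trans (firstRow-set m b c P Q rτ)
      (cong₂ _*_ (cong (λ w → ⟦ w ≟ b F.zero ⟧) (sumFin-permute n (λ j → b2n (r j)) τ))
                 (cong₂ _*_ (⟦⟧-cong (fixed-elsewhere rτ r (λ l≢x l≢y → cong r (τ-other l≢x l≢y)))
                                     (fixed-elsewhere r rτ (λ l≢x l≢y → cong r (sym (τ-other l≢x l≢y))))
                                     (fitsElsewhere? rτ c) (fitsElsewhere? r c))
                            (trans (cong₂ (λ α β → withdraw₂ α β (residual m (b ∘ F.suc) c rτ) P Q) (cong r τ-x) (cong r τ-y))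
                                   (withdraw₂-cong (r y) (r x) residual-τ P Q))))
      where
      rτ : Row
      rτ = r ∘ (τ ⟨$⟩ʳ_)
      fixed-elsewhere : ∀ s s′ → (∀ {l} → l ≢ x → l ≢ y → s l ≡ s′ l) → FitsElsewhere s c → FitsElsewhere s′ c
      fixed-elsewhere s s′ s≡s′ fits l l≢x l≢y = subst (λ v → b2n v ≤ c l) (s≡s′ l≢x l≢y) (fits l l≢x l≢y)
      residual-τ : ∀ p q → residual m (b ∘ F.suc) c rτ p q ≡ residual m (b ∘ F.suc) c r p q
      residual-τ p q = count-cong m (b ∘ F.suc) (agree
        (trans (set-x (c ⊖ rτ) p q) (sym (set-x (c ⊖ r) p q)))
        (trans (set-y (c ⊖ rτ) p q) (sym (set-y (c ⊖ r) p q)))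
        (λ l l≢x l≢y → trans (set-other (c ⊖ rτ) p q l≢x l≢y)
                             (trans (cong (λ k → c l ∸ b2n (r k)) (τ-other l≢x l≢y)) (sym (set-other (c ⊖ r) p q l≢x l≢y)))))

    count-doubled : ∀ m b c P Q → count (suc m) b (set c P Q) + count (suc m) b (set c P Q)
      ≡ sumL rows (λ r → (⟦ weight r ≟ b F.zero ⟧ * ⟦ fitsElsewhere? r c ⟧) * mirrored (residual m (b ∘ F.suc) c r) (r x) (r y) P Q)
    count-doubled m b c P Q = begin
      sumL rows row + sumL rows row                     ≡⟨ cong (sumL rows row +_) (sumL-rows-permute τ row (firstRow-resp m b _)) ⟨
      sumL rows row + sumL rows (row ∘ (_∘ (τ ⟨$⟩ʳ_)))  ≡⟨ sumL-+ rows row _ ⟨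
      sumL rows (λ r → row r + row (r ∘ (τ ⟨$⟩ʳ_)))     ≡⟨ sumL-cong rows (λ r → trans (cong₂ _+_ (firstRow-set m b c P Q r) (firstRow-set-mirror m b c P Q r))
                                                                                      (*-distrib-+₂ ⟦ weight r ≟ b F.zero ⟧ ⟦ fitsElsewhere? r c ⟧ _ _)) ⟩
      sumL rows (λ r → (⟦ weight r ≟ b F.zero ⟧ * ⟦ fitsElsewhere? r c ⟧) * mirrored (residual m (b ∘ F.suc) c r) (r x) (r y) P Q) ∎
      where
      open ≡-Reasoning
      row : Row → ℕ
      row = firstRow m b (set c P Q)
      *-distrib-+₂ : ∀ a b u v → a * (b * u) + a * (b * v) ≡ (a * b) * (u + v)
      *-distrib-+₂ a b u v = trans (sym (*-distribˡ-+ a (b * u) (b * v)))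
                                   (trans (cong (a *_) (sym (*-distribˡ-+ b u v))) (sym (*-assoc a b (u + v))))

    -- Summing each first row together with its mirror image under τ turns the claim into mirrored-balance
    -- for the residual counts of the remaining rows.
    count-balance : ∀ m b c {p q} → q < p → count m b (set c (suc p) q) <₀ count m b (set c p (suc q))
    count-balance zero b c {p} {q} _ =
      inj₁ (⟦⟧-no (zero? (set c (suc p) q)) λ all-zero → 1+n≢0 (trans (sym (set-x c (suc p) q)) (all-zero x)))
    count-balance (suc m) b c {p} {q} q<p =
      <₀-halve (subst₂ _<₀_ (sym (count-doubled m b c (suc p) q)) (sym (count-doubled m b c p (suc q)))
        (sumL-mono-<₀ rows λ r → *-monoʳ-<₀ (⟦ weight r ≟ b F.zero ⟧ * ⟦ fitsElsewhere? r c ⟧)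
          (Balancing.mirrored-balance (residual m b′ c r) (count-set-swap m b′ (c ⊖ r)) (count-balance m b′ (c ⊖ r))
                                      (r x) (r y) q<p)))
      where
      b′ : Fin m → ℕ
      b′ = b ∘ F.suc

  count-transfer : ∀ m b {i j c c′} → i ≢ j → Transfer i j c c′ → c′ j ≤ c′ i → count m b c <₀ count m b c′
  count-transfer m b {i} {j} {c} {c′} i≢j t c′j≤c′i =
    subst₂ _<₀_ (count-cong m b (sym ∘ before)) (count-cong m b (sym ∘ after))
           (count-balance m b c′ (subst (_≤ c′ i) target c′j≤c′i))
    where
    open Transfer t
    open TwoColumns i j i≢j
    before : c ≗ set c′ (suc (c′ i)) (c j)
    before = agree (trans source (sym (set-x c′ _ _))) (sym (set-y c′ _ _))
                   (λ l l≢i l≢j → trans (sym (others l l≢i l≢j)) (sym (set-other c′ _ _ l≢i l≢j)))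
    after : c′ ≗ set c′ (c′ i) (suc (c j))
    after = agree (sym (set-x c′ _ _)) (trans target (sym (set-y c′ _ _)))
                  (λ l l≢i l≢j → sym (set-other c′ _ _ l≢i l≢j))

corollary2 : (n : ℕ) (a a' b : DegList n) →
    LoopDigraphic a b → LoopDigraphic a' b →
    ¬ (∀ i → a i ≡ a' i) →
    Nonincreasing a → a ≺ a' →
    N₁ a' b < N₁ a b
corollary2 n a a′ b _ realizable′ a≢a′ a-nonincreasing a≺a′ =
  subst₂ _<_ (sym (N₁≡count a′ b)) (sym (N₁≡count a b))
         (<₀-pos⇒< (majorization-descent a≺a′ a≢a′) (subst (0 <_) (N₁≡count a′ b) (N₁-pos a′ b realizable′)))
  where
  open Realizations n
  open Majorization a a-nonincreasing (count n b) (count-cong n b) (count-transfer n b)
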